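{- Let $R$ be a field of characteristic $0$ and let $J\in R\langle\langle X,Y\rangle\rangle$ be a group-like element, written as $J=\sum_{\mathbf{k}\in\mathbb{N}_0^{(\infty)}}c_{\mathbf{k}}w_{\mathbf{k}}$ with $c_{\mathbf{k}}\in R$, and let $c_X:=c_{(;1)}$ be the coefficient of $X$ in $J$. Then for every $(k_1,\dots,k_d;k_\infty)\in\mathbb{N}_0^{(\infty)}$, $$c_{(k_1,\dots,k_d;k_\infty)}=\sum_{\substack{s,t\ge0\\ s+t=k_\infty}}(-1)^s\frac{(c_X)^t}{t!}\sum_{\substack{s_1,\dots,s_d\ge0\\ s_1+\cdots+s_d=s}}\binom{k_1+s_1}{k_1}\cdots\binom{k_d+s_d}{k_d}\,c_{(k_1+s_1,\dots,k_d+s_d;0)}.$$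
   Context: $R\langle\langle X,Y\rangle\rangle$ is the ring of non-commutative formal power series in $X,Y$ over $R$. $\mathbb{N}_0^{(\infty)}$ is the set of tuples $\mathbf{k}=(k_1,\dots,k_d;k_\infty)$, $d\ge0$, of non-negative integers, and $w_{\mathbf{k}}=X^{k_1}Y\cdots X^{k_d}YX^{k_\infty}$ (these run over all words in $X,Y$, including $1$). Let $\Delta$ be the continuous algebra homomorphism $R\langle\langle X,Y\rangle\rangle\to R\langle\langle X,Y\rangle\rangle\hat\otimes R\langle\langle X,Y\rangle\rangle$ with $\Delta(X)=X\otimes1+1\otimes X$, $\Delta(Y)=Y\otimes1+1\otimes Y$. An element $J$ is group-like if its constant term is $1$ and $\Delta(J)=J\otimes J$. -}

module Defs where

open import Level using (Level; _⊔_; suc)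
open import Algebra.Bundles using (CommutativeRing)
open import Data.Nat as ℕ using (ℕ; zero; _∸_)
open import Data.Nat.Combinatorics using (_C_)
open import Data.List using (List; []; _∷_; _++_; map; concatMap; foldr; replicate; upTo; zipWith; length)
open import Data.Nat.ListAction using (product)
open import Data.Product using (_×_; _,_)
open import Relation.Nullary using (¬_; Dec; yes; no)
open import Relation.Binary.PropositionalEquality using (_≡_)

record Field (c ℓ : Level) : Set (suc (c ⊔ ℓ)) where
  field
    commutativeRing : CommutativeRing c ℓ
  open CommutativeRing commutativeRing public
  field
    _⁻¹      : Carrier → Carrier
    0≉1      : ¬ (0# ≈ 1#)
    ⁻¹-inverse : ∀ x → ¬ (x ≈ 0#) → x * (x ⁻¹) ≈ 1#

data Letter : Set where
  X Y : Letter

Word : Set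
Word = List Letter

_≟L_ : (a b : Letter) → Dec (a ≡ b)
X ≟L X = yes _≡_.refl
X ≟L Y = no λ ()
Y ≟L X = no λ ()
Y ≟L Y = yes _≡_.refl

_≟W_ : (u v : Word) → Dec (u ≡ v)
[] ≟W [] = yes _≡_.refl
[] ≟W (_ ∷ _) = no λ ()
(_ ∷ _) ≟W [] = no λ ()
(a ∷ u) ≟W (b ∷ v) with a ≟L b | u ≟W v
... | yes _≡_.refl | yes _≡_.refl = yes _≡_.refl
... | no a≢b | _ = no λ { _≡_.refl → a≢b _≡_.refl }
... | yes _ | no u≢v = no λ { _≡_.refl → u≢v _≡_.refl }

wordsOfLength : ℕ → List Word
wordsOfLength zero = [] ∷ []
wordsOfLength (ℕ.suc n) = concatMap (λ w → (X ∷ w) ∷ (Y ∷ w) ∷ []) (wordsOfLength n)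

-- Δ(w) = Π_{letters a of w} (a ⊗ 1 + 1 ⊗ a), expanded as a list of
-- pure tensors u ⊗ v (with multiplicity).
Δword : Word → List (Word × Word)
Δword [] = ([] , []) ∷ []
Δword (a ∷ w) = concatMap (λ { (u , v) → (a ∷ u , v) ∷ (u , a ∷ v) ∷ [] }) (Δword w)

-- w_k = X^{k₁} Y ⋯ X^{k_d} Y X^{k_∞}
wₖ : List ℕ → ℕ → Word
wₖ ks k∞ = foldr (λ k w → replicate k X ++ (Y ∷ w)) (replicate k∞ X) ks

compositions : ℕ → ℕ → List (List ℕ)
compositions zero zero = [] ∷ []
compositions zero (ℕ.suc _) = []
compositions (ℕ.suc d) s =
  concatMap (λ s₁ → map (s₁ ∷_) (compositions d (s ∸ s₁))) (upTo (ℕ.suc s))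

module FieldOps {c ℓ} (F : Field c ℓ) where
  open Field F
  open import Algebra.Definitions.RawMonoid (CommutativeRing.+-rawMonoid commutativeRing) public
    using () renaming (_×_ to _·_)

  -- R⟨⟨X,Y⟩⟩ : a series is its coefficient function on words
  Series : Set c
  Series = Word → Carrier

  Σ : List Carrier → Carrier
  Σ = foldr _+_ 0#

  _^_ : Carrier → ℕ → Carrier
  x ^ zero = 1#
  x ^ ℕ.suc n = x * (x ^ n)

  -- coefficient of u ⊗ v in Δ(J) (Δ is homogeneous, so only words w
  -- of length |u| + |v| contribute)
  ΔCoeff : Series → Word → Word → Carrier
  ΔCoeff J u v =
    Σ (map (λ w → Σ (map (λ { (u' , v') → indicator u' v' (J w) }) (Δword w)))
           (wordsOfLength (length u ℕ.+ length v)))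
    where
    indicator : Word → Word → Carrier → Carrier
    indicator u' v' x with u' ≟W u | v' ≟W v
    ... | yes _ | yes _ = x
    ... | _ | _ = 0#

  -- J ⊗ J has coefficient J(u) J(v) at u ⊗ v
  IsGroupLike : Series → Set ℓ
  IsGroupLike J = (J [] ≈ 1#) × (∀ u v → ΔCoeff J u v ≈ J u * J v)

  CharZero : Set ℓ
  CharZero = ∀ n → (n · 1#) ≈ 0# → n ≡ 0

  rhs : Series → List ℕ → ℕ → Carrier
  rhs J ks k∞ =
    Σ (map (λ s →
        let t = k∞ ∸ s in
        ((- 1#) ^ s) * ((J (X ∷ []) ^ t) * (((t ℕ.!) · 1#) ⁻¹)) *
        Σ (map (λ ss →
            (product (zipWith (λ k sᵢ → (k ℕ.+ sᵢ) C k) ks ss) · J (wₖ (zipWith ℕ._+_ ks ss) 0)))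
          (compositions (length ks) s)))
      (upTo (ℕ.suc k∞)))

{-# OPTIONS --safe #-}
module Submission where

-- Comparing the coefficients of u ⊗ X in Δ(J) = J ⊗ J gives J(u) c_X = Σ_{w ∈ u ш X} J(w), the sum over all
-- ways of inserting one letter X into u.  For u = w_(k;k∞) this is the recurrence
--   c_(k;k∞) c_X = (k∞ + 1) c_(k;k∞+1) + Σᵢ (kᵢ + 1) c_(k+eᵢ;k∞),
-- which in characteristic 0 determines every coefficient from those with k∞ = 0.  The right-hand side of the
-- theorem is the Cauchy product of (−1)^s B_s(k), B_s the inner binomial sum, with c_X^t / t!.  It satisfies the
-- same recurrence because Σᵢ (kᵢ + 1) B_s(k + eᵢ) = (s + 1) B_{s+1}(k), by the absorption identity
-- (sᵢ + 1) C(kᵢ + sᵢ + 1, kᵢ) = (kᵢ + 1) C(kᵢ + sᵢ + 1, kᵢ + 1), and it equals c_(k;0) when k∞ = 0.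

open import Defs
open import Data.Nat as ℕ using (ℕ; zero; suc; _∸_; _!)
open import Data.Nat.Properties as ℕ using (+-suc; suc-injective)
open import Data.Nat.Combinatorics using (_C_; nCn≡1; nC1≡n; nCk≡nC[n∸k]; nCk+nC[k+1]≡[n+1]C[k+1])
open import Data.Nat.ListAction using (product)
open import Data.Nat.Tactic.RingSolver using (solve-∀)
open import Data.List using (List; []; _∷_; _++_; map; concatMap; replicate; upTo; applyUpTo; zipWith; length)
open import Data.List.Properties using (map-++; map-cong; map-∘; map-upTo)
open import Data.Product using (_×_; _,_; proj₁; proj₂)
open import Relation.Binary.PropositionalEquality as ≡ using (_≡_; _≢_)
open import Relation.Nullary using (¬_; yes; no)

[k+0]Ck≡1 : ∀ k → (k ℕ.+ 0) C k ≡ 1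
[k+0]Ck≡1 k = ≡.trans (≡.cong (_C k) (ℕ.+-identityʳ k)) (nCn≡1 k)

[1+k]Ck≡1+k : ∀ k → suc k C k ≡ suc k
[1+k]Ck≡1+k k = begin
  suc k C k             ≡⟨ nCk≡nC[n∸k] (ℕ.n≤1+n k) ⟩
  suc k C (suc k ∸ k)   ≡⟨ ≡.cong (suc k C_) (ℕ.m+n∸n≡m 1 k) ⟩
  suc k C 1             ≡⟨ nC1≡n (suc k) ⟩
  suc k                 ∎
  where open ≡.≡-Reasoning

[1+u]*[k+1+u]Ck≡[1+k]*[k+1+u]C[1+k] : ∀ k u →
  suc u ℕ.* ((k ℕ.+ suc u) C k) ≡ suc k ℕ.* ((suc k ℕ.+ u) C suc k)
[1+u]*[k+1+u]Ck≡[1+k]*[k+1+u]C[1+k] zero u = begin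
  suc u ℕ.* 1         ≡⟨ ℕ.*-identityʳ (suc u) ⟩
  suc u               ≡⟨ nC1≡n (suc u) ⟨
  suc u C 1           ≡⟨ ℕ.*-identityˡ _ ⟨
  1 ℕ.* (suc u C 1)   ∎
  where open ≡.≡-Reasoning
[1+u]*[k+1+u]Ck≡[1+k]*[k+1+u]C[1+k] (suc k) zero = begin
  1 ℕ.* ((suc k ℕ.+ 1) C suc k)                        ≡⟨ ℕ.*-identityˡ _ ⟩
  (suc k ℕ.+ 1) C suc k                                ≡⟨ ≡.cong (_C suc k) (ℕ.+-comm (suc k) 1) ⟩
  suc (suc k) C suc k                                  ≡⟨ [1+k]Ck≡1+k (suc k) ⟩
  suc (suc k)                                          ≡⟨ ℕ.*-identityʳ _ ⟨
  suc (suc k) ℕ.* 1                                    ≡⟨ ≡.cong (suc (suc k) ℕ.*_) ([k+0]Ck≡1 (suc (suc k))) ⟨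
  suc (suc k) ℕ.* ((suc (suc k) ℕ.+ 0) C suc (suc k))  ∎
  where open ≡.≡-Reasoning
[1+u]*[k+1+u]Ck≡[1+k]*[k+1+u]C[1+k] (suc k) (suc u) = begin
  suc (suc u) ℕ.* (suc (k ℕ.+ suc (suc u)) C suc k)
    ≡⟨ ≡.cong (suc (suc u) ℕ.*_) (nCk+nC[k+1]≡[n+1]C[k+1] (k ℕ.+ suc (suc u)) k) ⟨
  suc (suc u) ℕ.* ((k ℕ.+ suc (suc u)) C k ℕ.+ (k ℕ.+ suc (suc u)) C suc k)
    ≡⟨ ℕ.*-distribˡ-+ (suc (suc u)) ((k ℕ.+ suc (suc u)) C k) ((k ℕ.+ suc (suc u)) C suc k) ⟩
  suc (suc u) ℕ.* ((k ℕ.+ suc (suc u)) C k) ℕ.+ suc (suc u) ℕ.* ((k ℕ.+ suc (suc u)) C suc k)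
    ≡⟨ ≡.cong₂ ℕ._+_ ([1+u]*[k+1+u]Ck≡[1+k]*[k+1+u]C[1+k] k (suc u))
                     (≡.cong (λ n → suc (suc u) ℕ.* (n C suc k)) (+-suc k (suc u))) ⟩
  suc k ℕ.* m ℕ.+ suc (suc u) ℕ.* m
    ≡⟨ regroup (suc k) (suc u) m ⟩
  suc (suc k) ℕ.* m ℕ.+ suc u ℕ.* m
    ≡⟨ ≡.cong (suc (suc k) ℕ.* m ℕ.+_) ([1+u]*[k+1+u]Ck≡[1+k]*[k+1+u]C[1+k] (suc k) u) ⟩
  suc (suc k) ℕ.* m ℕ.+ suc (suc k) ℕ.* ((suc (suc k) ℕ.+ u) C suc (suc k))
    ≡⟨ ℕ.*-distribˡ-+ (suc (suc k)) m ((suc (suc k) ℕ.+ u) C suc (suc k)) ⟨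
  suc (suc k) ℕ.* (m ℕ.+ (suc (suc k) ℕ.+ u) C suc (suc k))
    ≡⟨ ≡.cong (λ n → suc (suc k) ℕ.* (m ℕ.+ suc n C suc (suc k))) (+-suc k u) ⟨
  suc (suc k) ℕ.* (m ℕ.+ (suc k ℕ.+ suc u) C suc (suc k))
    ≡⟨ ≡.cong (suc (suc k) ℕ.*_) (nCk+nC[k+1]≡[n+1]C[k+1] (suc k ℕ.+ suc u) (suc k)) ⟩
  suc (suc k) ℕ.* ((suc (suc k) ℕ.+ suc u) C suc (suc k)) ∎
  where
  open ≡.≡-Reasoning
  m = (suc k ℕ.+ suc u) C suc k
  regroup : ∀ a b m → a ℕ.* m ℕ.+ suc b ℕ.* m ≡ suc a ℕ.* m ℕ.+ b ℕ.* m
  regroup = solve-∀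

replicate-++-∷ : ∀ {A : Set} k (x : A) xs → replicate k x ++ x ∷ xs ≡ x ∷ replicate k x ++ xs
replicate-++-∷ zero    x xs = ≡.refl
replicate-++-∷ (suc k) x xs = ≡.cong (x ∷_) (replicate-++-∷ k x xs)

_ш_ : Word → Word → List Word
[]      ш v       = v ∷ []
(a ∷ u) ш []      = (a ∷ u) ∷ []
(a ∷ u) ш (b ∷ v) = map (a ∷_) (u ш (b ∷ v)) ++ map (b ∷_) ((a ∷ u) ш v)

ш-identityʳ : ∀ u → u ш [] ≡ u ∷ []
ш-identityʳ []      = ≡.refl
ш-identityʳ (_ ∷ _) = ≡.refl

module Coefficients {c ℓ} (F : Field c ℓ) where

  open Field F
  open FieldOps F
  open import Relation.Binary.Reasoning.Setoid setoid
  open import Algebra.Properties.Semiring.Mult semiring using (×-homo-+; ×1-homo-*; ×-assoc-*; ×-congʳ; ×-congˡ)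
  open import Algebra.Properties.Ring ring using (-1*x≈-x)
  open import Algebra.Properties.Group +-group using (∙-cancelʳ)
  open import Algebra.Properties.CommutativeSemigroup +-commutativeSemigroup using (interchange; xy∙z≈xz∙y)
  open import Algebra.Properties.CommutativeSemigroup *-commutativeSemigroup using (x∙yz≈y∙xz; x∙yz≈yx∙z)
  open import Algebra.Solver.Ring.NaturalCoefficients.Default commutativeSemiring

  ι : ℕ → Carrier
  ι n = n · 1#

  ·≈ι* : ∀ n x → n · x ≈ ι n * x
  ·≈ι* n x = sym (trans (×-assoc-* n 1# x) (×-congʳ n (*-identityˡ x)))

  ι[1+n]*x≈x+ι[n]*x : ∀ n x → ι (suc n) * x ≈ x + ι n * x
  ι[1+n]*x≈x+ι[n]*x n x = trans (distribʳ x 1# (ι n)) (+-congʳ (*-identityˡ x))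

  Σ-++ : ∀ xs ys → Σ (xs ++ ys) ≈ Σ xs + Σ ys
  Σ-++ []       ys = sym (+-identityˡ (Σ ys))
  Σ-++ (x ∷ xs) ys = trans (+-congˡ (Σ-++ xs ys)) (sym (+-assoc x (Σ xs) (Σ ys)))

  module _ {A : Set} where

    Σ-map-cong : ∀ {f g : A → Carrier} → (∀ x → f x ≈ g x) → ∀ xs → Σ (map f xs) ≈ Σ (map g xs)
    Σ-map-cong f≈g []       = refl
    Σ-map-cong f≈g (x ∷ xs) = +-cong (f≈g x) (Σ-map-cong f≈g xs)

    Σ-map-0 : ∀ {f : A → Carrier} → (∀ x → f x ≈ 0#) → ∀ xs → Σ (map f xs) ≈ 0#
    Σ-map-0 f≈0 []       = refl
    Σ-map-0 f≈0 (x ∷ xs) = trans (+-cong (f≈0 x) (Σ-map-0 f≈0 xs)) (+-identityˡ 0#)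

    Σ-map-+ : ∀ (f g : A → Carrier) xs → Σ (map (λ x → f x + g x) xs) ≈ Σ (map f xs) + Σ (map g xs)
    Σ-map-+ f g []       = sym (+-identityˡ 0#)
    Σ-map-+ f g (x ∷ xs) = trans (+-congˡ (Σ-map-+ f g xs)) (interchange (f x) (g x) _ _)

    Σ-map-*ˡ : ∀ a (f : A → Carrier) xs → Σ (map (λ x → a * f x) xs) ≈ a * Σ (map f xs)
    Σ-map-*ˡ a f []       = sym (zeroʳ a)
    Σ-map-*ˡ a f (x ∷ xs) = trans (+-congˡ (Σ-map-*ˡ a f xs)) (sym (distribˡ a (f x) _))

    Σ-map-concatMap : ∀ {B : Set} (f : B → Carrier) (g : A → List B) xs →
      Σ (map f (concatMap g xs)) ≈ Σ (map (λ x → Σ (map f (g x))) xs)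
    Σ-map-concatMap f g []       = refl
    Σ-map-concatMap f g (x ∷ xs) = begin
      Σ (map f (g x ++ concatMap g xs))                     ≡⟨ ≡.cong Σ (map-++ f (g x) (concatMap g xs)) ⟩
      Σ (map f (g x) ++ map f (concatMap g xs))              ≈⟨ Σ-++ (map f (g x)) _ ⟩
      Σ (map f (g x)) + Σ (map f (concatMap g xs))           ≈⟨ +-congˡ (Σ-map-concatMap f g xs) ⟩
      Σ (map f (g x)) + Σ (map (λ x → Σ (map f (g x))) xs)  ∎

  -- Conv n h = Σ_{u + v = n} h u v
  Conv : ℕ → (ℕ → ℕ → Carrier) → Carrier
  Conv zero    h = h 0 0
  Conv (suc n) h = h 0 (suc n) + Conv n (λ u v → h (suc u) v)

  Conv-cong : ∀ n {h g : ℕ → ℕ → Carrier} → (∀ u v → h u v ≈ g u v) → Conv n h ≈ Conv n g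
  Conv-cong zero    h≈g = h≈g 0 0
  Conv-cong (suc n) h≈g = +-cong (h≈g 0 (suc n)) (Conv-cong n (λ u v → h≈g (suc u) v))

  Conv-zero : ∀ n → Conv n (λ _ _ → 0#) ≈ 0#
  Conv-zero zero    = refl
  Conv-zero (suc n) = trans (+-identityˡ _) (Conv-zero n)

  Conv-+ : ∀ n (h g : ℕ → ℕ → Carrier) → Conv n (λ u v → h u v + g u v) ≈ Conv n h + Conv n g
  Conv-+ zero    h g = refl
  Conv-+ (suc n) h g = trans (+-congˡ (Conv-+ n _ _)) (interchange _ _ _ _)

  Conv-*ˡ : ∀ n a (h : ℕ → ℕ → Carrier) → Conv n (λ u v → a * h u v) ≈ a * Conv n h
  Conv-*ˡ zero    a h = refl
  Conv-*ˡ (suc n) a h = trans (+-congˡ (Conv-*ˡ n a _)) (sym (distribˡ a _ _))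

  Conv-suc-last : ∀ n h → Conv (suc n) h ≈ Conv n (λ u v → h u (suc v)) + h (suc n) 0
  Conv-suc-last zero    h = refl
  Conv-suc-last (suc n) h = trans (+-congˡ (Conv-suc-last n (λ u v → h (suc u) v))) (sym (+-assoc _ _ _))

  Conv-antidiagonal : ∀ n (φ : ℕ → ℕ → ℕ → Carrier) → Conv n (λ u v → φ (u ℕ.+ v) u v) ≈ Conv n (φ n)
  Conv-antidiagonal zero    φ = refl
  Conv-antidiagonal (suc n) φ = +-congˡ (Conv-antidiagonal n (λ m u v → φ (suc m) (suc u) v))

  -- The coefficient form of the product rule (f g)′ = f′ g + f g′.
  Conv-leibniz : ∀ n h →
    ι (suc n) * Conv (suc n) h ≈
      Conv n (λ u v → ι (suc u) * h (suc u) v) + Conv n (λ u v → ι (suc v) * h u (suc v))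
  Conv-leibniz n h = begin
    ι (suc n) * Conv (suc n) h
      ≈⟨ Conv-*ˡ (suc n) _ h ⟨
    Conv (suc n) (λ u v → ι (suc n) * h u v)
      ≈⟨ Conv-antidiagonal (suc n) (λ m u v → ι m * h u v) ⟨
    Conv (suc n) (λ u v → ι (u ℕ.+ v) * h u v)
      ≈⟨ Conv-cong (suc n) (λ u v → trans (*-congʳ (×-homo-+ 1# u v)) (distribʳ (h u v) (ι u) (ι v))) ⟩
    Conv (suc n) (λ u v → ι u * h u v + ι v * h u v)
      ≈⟨ Conv-+ (suc n) (λ u v → ι u * h u v) (λ u v → ι v * h u v) ⟩
    Conv (suc n) (λ u v → ι u * h u v) + Conv (suc n) (λ u v → ι v * h u v)
      ≈⟨ +-cong (trans (+-congʳ (zeroˡ _)) (+-identityˡ _))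
                (trans (Conv-suc-last n (λ u v → ι v * h u v)) (trans (+-congˡ (zeroˡ _)) (+-identityʳ _))) ⟩
    Conv n (λ u v → ι (suc u) * h (suc u) v) + Conv n (λ u v → ι (suc v) * h u (suc v)) ∎

  Σ-upTo≈Conv : ∀ n h → Σ (map (λ s → h s (n ∸ s)) (upTo (suc n))) ≈ Conv n h
  Σ-upTo≈Conv n h = trans (reflexive (≡.cong Σ (map-upTo _ (suc n)))) (Σ-applyUpTo≈Conv n h)
    where
    Σ-applyUpTo≈Conv : ∀ n h → Σ (applyUpTo (λ s → h s (n ∸ s)) (suc n)) ≈ Conv n h
    Σ-applyUpTo≈Conv zero    h = +-identityʳ _
    Σ-applyUpTo≈Conv (suc n) h = +-congˡ (Σ-applyUpTo≈Conv n (λ u v → h (suc u) v))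

  ⁻¹-unique : ∀ {x y} → ¬ x ≈ 0# → x * y ≈ 1# → y ≈ x ⁻¹
  ⁻¹-unique {x} {y} x≉0 xy≈1 = begin
    y                ≈⟨ *-identityʳ y ⟨
    y * 1#           ≈⟨ *-congˡ (⁻¹-inverse x x≉0) ⟨
    y * (x * x ⁻¹)   ≈⟨ *-assoc y x (x ⁻¹) ⟨
    y * x * x ⁻¹     ≈⟨ *-congʳ (trans (*-comm y x) xy≈1) ⟩
    1# * x ⁻¹        ≈⟨ *-identityˡ (x ⁻¹) ⟩
    x ⁻¹             ∎

  *-cancelˡ-≉0 : ∀ {x y z} → ¬ x ≈ 0# → x * y ≈ x * z → y ≈ z
  *-cancelˡ-≉0 {x} {y} {z} x≉0 xy≈xz = begin
    y                  ≈⟨ *-identityˡ y ⟨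
    1# * y             ≈⟨ *-congʳ (trans (*-comm _ _) (⁻¹-inverse x x≉0)) ⟨
    x ⁻¹ * x * y       ≈⟨ *-assoc _ _ _ ⟩
    x ⁻¹ * (x * y)     ≈⟨ *-congˡ xy≈xz ⟩
    x ⁻¹ * (x * z)     ≈⟨ *-assoc _ _ _ ⟨
    x ⁻¹ * x * z       ≈⟨ *-congʳ (trans (*-comm _ _) (⁻¹-inverse x x≉0)) ⟩
    1# * z             ≈⟨ *-identityˡ z ⟩
    z                  ∎

  δ : Letter → Letter → Carrier → Carrier
  δ X X x = x
  δ Y Y x = x
  δ X Y x = 0#
  δ Y X x = 0#

  δ-sum : ∀ a (f : Letter → Carrier) → δ a X (f X) + δ a Y (f Y) ≈ f a
  δ-sum X f = +-identityʳ (f X)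
  δ-sum Y f = +-identityˡ (f Y)

  Σ-map-δ : ∀ {A : Set} a b (f : A → Carrier) xs → Σ (map (λ x → δ a b (f x)) xs) ≈ δ a b (Σ (map f xs))
  Σ-map-δ X X f xs = refl
  Σ-map-δ Y Y f xs = refl
  Σ-map-δ X Y f xs = Σ-map-0 (λ _ → refl) xs
  Σ-map-δ Y X f xs = Σ-map-0 (λ _ → refl) xs

  indicator : Word → Word → Word × Word → Carrier → Carrier
  indicator u v (u′ , v′) x with u′ ≟W u | v′ ≟W v
  ... | yes _ | yes _ = x
  ... | _     | _     = 0#

  indicator-∷ˡ : ∀ a b u v u′ v′ x → indicator (a ∷ u) v (b ∷ u′ , v′) x ≡ δ a b (indicator u v (u′ , v′) x)
  indicator-∷ˡ X Y u v u′ v′ x = ≡.refl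
  indicator-∷ˡ Y X u v u′ v′ x = ≡.refl
  indicator-∷ˡ X X u v u′ v′ x with u′ ≟W u | v′ ≟W v
  ... | yes ≡.refl | yes _ = ≡.refl
  ... | yes ≡.refl | no _  = ≡.refl
  ... | no _       | _     = ≡.refl
  indicator-∷ˡ Y Y u v u′ v′ x with u′ ≟W u | v′ ≟W v
  ... | yes ≡.refl | yes _ = ≡.refl
  ... | yes ≡.refl | no _  = ≡.refl
  ... | no _       | _     = ≡.refl

  indicator-∷ʳ : ∀ a b u v u′ v′ x → indicator u (a ∷ v) (u′ , b ∷ v′) x ≡ δ a b (indicator u v (u′ , v′) x)
  indicator-∷ʳ X X u v u′ v′ x with u′ ≟W u | v′ ≟W v
  ... | yes _ | yes ≡.refl = ≡.refl
  ... | yes _ | no _       = ≡.refl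
  ... | no _  | _          = ≡.refl
  indicator-∷ʳ Y Y u v u′ v′ x with u′ ≟W u | v′ ≟W v
  ... | yes _ | yes ≡.refl = ≡.refl
  ... | yes _ | no _       = ≡.refl
  ... | no _  | _          = ≡.refl
  indicator-∷ʳ X Y u v u′ v′ x with u′ ≟W u
  ... | yes _ = ≡.refl
  ... | no _  = ≡.refl
  indicator-∷ʳ Y X u v u′ v′ x with u′ ≟W u
  ... | yes _ = ≡.refl
  ... | no _  = ≡.refl

  indicator-[]ʳ : ∀ b u u′ v′ x → indicator u [] (u′ , b ∷ v′) x ≡ 0#
  indicator-[]ʳ b u u′ v′ x with u′ ≟W u
  ... | yes _ = ≡.refl
  ... | no _  = ≡.refl

  ΔCoeffOfLength : ℕ → Series → Word → Word → Carrier
  ΔCoeffOfLength m H u v = Σ (map (λ w → Σ (map (λ p → indicator u v p (H w)) (Δword w))) (wordsOfLength m))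

  -- The left-hand side is the summand of ΔCoeff, whose indicator is local to Defs and cannot be named; it is
  -- solved by unification from its use below, hence the mutual block.
  mutual
    indicator-agrees : ∀ H u v w p → _ ≡ indicator u v p (H w)

    ΔCoeff≡ΔCoeffOfLength : ∀ H u v → ΔCoeff H u v ≡ ΔCoeffOfLength (length u ℕ.+ length v) H u v
    ΔCoeff≡ΔCoeffOfLength H u v =
      ≡.cong Σ (map-cong (λ w → ≡.cong Σ (map-cong (indicator-agrees H u v w) (Δword w))) (wordsOfLength (length u ℕ.+ length v)))

    indicator-agrees H u v w (u′ , v′) with u′ ≟W u | v′ ≟W v
    ... | yes _ | yes _ = ≡.refl
    ... | yes _ | no _  = ≡.refl
    ... | no _  | _     = ≡.refl

  Σ-wordsOfLength-suc : ∀ m (f : Word → Carrier) →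
    Σ (map f (wordsOfLength (suc m))) ≈ Σ (map (λ w → f (X ∷ w) + f (Y ∷ w)) (wordsOfLength m))
  Σ-wordsOfLength-suc m f =
    trans (Σ-map-concatMap f _ (wordsOfLength m)) (Σ-map-cong (λ w → +-congˡ (+-identityʳ (f (Y ∷ w)))) (wordsOfLength m))

  Σ-Δword-∷ : ∀ b w (f : Word × Word → Carrier) →
    Σ (map f (Δword (b ∷ w))) ≈
      Σ (map (λ p → f (b ∷ proj₁ p , proj₂ p)) (Δword w)) + Σ (map (λ p → f (proj₁ p , b ∷ proj₂ p)) (Δword w))
  Σ-Δword-∷ b w f = begin
    Σ (map f (Δword (b ∷ w)))
      ≈⟨ Σ-map-concatMap f _ (Δword w) ⟩
    Σ (map (λ p → f (b ∷ proj₁ p , proj₂ p) + (f (proj₁ p , b ∷ proj₂ p) + 0#)) (Δword w))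
      ≈⟨ Σ-map-cong (λ p → +-congˡ (+-identityʳ _)) (Δword w) ⟩
    Σ (map (λ p → f (b ∷ proj₁ p , proj₂ p) + f (proj₁ p , b ∷ proj₂ p)) (Δword w))
      ≈⟨ Σ-map-+ _ _ (Δword w) ⟩
    Σ (map (λ p → f (b ∷ proj₁ p , proj₂ p)) (Δword w)) + Σ (map (λ p → f (proj₁ p , b ∷ proj₂ p)) (Δword w)) ∎

  peelˡ peelʳ : ℕ → Series → Word → Word → Carrier
  peelˡ m H []      v       = 0#
  peelˡ m H (a ∷ u) v       = ΔCoeffOfLength m (λ w → H (a ∷ w)) u v
  peelʳ m H u       []      = 0#
  peelʳ m H u       (b ∷ v) = ΔCoeffOfLength m (λ w → H (b ∷ w)) u v

  leftPart rightPart : Series → Word → Word → Letter → Word → Carrier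
  leftPart  H u v b w = Σ (map (λ p → indicator u v (b ∷ proj₁ p , proj₂ p) (H (b ∷ w))) (Δword w))
  rightPart H u v b w = Σ (map (λ p → indicator u v (proj₁ p , b ∷ proj₂ p) (H (b ∷ w))) (Δword w))

  Σ-leftPart : ∀ m H u v →
    Σ (map (λ w → leftPart H u v X w + leftPart H u v Y w) (wordsOfLength m)) ≈ peelˡ m H u v
  Σ-leftPart m H []      v = Σ-map-0 (λ w → trans (+-cong (Σ-map-0 (λ _ → refl) (Δword w)) (Σ-map-0 (λ _ → refl) (Δword w))) (+-identityˡ 0#)) (wordsOfLength m)
  Σ-leftPart m H (a ∷ u) v = Σ-map-cong (λ w → trans (+-cong (peel X w) (peel Y w)) (δ-sum a (λ b → S b w))) (wordsOfLength m)
    where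
    S : Letter → Word → Carrier
    S b w = Σ (map (λ p → indicator u v p (H (b ∷ w))) (Δword w))
    peel : ∀ b w → leftPart H (a ∷ u) v b w ≈ δ a b (S b w)
    peel b w = trans (reflexive (≡.cong Σ (map-cong (λ p → indicator-∷ˡ a b u v (proj₁ p) (proj₂ p) (H (b ∷ w))) (Δword w))))
                     (Σ-map-δ a b _ (Δword w))

  Σ-rightPart : ∀ m H u v →
    Σ (map (λ w → rightPart H u v X w + rightPart H u v Y w) (wordsOfLength m)) ≈ peelʳ m H u v
  Σ-rightPart m H u [] = Σ-map-0 (λ w → trans (+-cong (vanish X w) (vanish Y w)) (+-identityˡ 0#)) (wordsOfLength m)
    where
    vanish : ∀ b w → rightPart H u [] b w ≈ 0#
    vanish b w = Σ-map-0 (λ p → reflexive (indicator-[]ʳ b u (proj₁ p) (proj₂ p) (H (b ∷ w)))) (Δword w)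
  Σ-rightPart m H u (a ∷ v) = Σ-map-cong (λ w → trans (+-cong (peel X w) (peel Y w)) (δ-sum a (λ b → S b w))) (wordsOfLength m)
    where
    S : Letter → Word → Carrier
    S b w = Σ (map (λ p → indicator u v p (H (b ∷ w))) (Δword w))
    peel : ∀ b w → rightPart H u (a ∷ v) b w ≈ δ a b (S b w)
    peel b w = trans (reflexive (≡.cong Σ (map-cong (λ p → indicator-∷ʳ a b u v (proj₁ p) (proj₂ p) (H (b ∷ w))) (Δword w))))
                     (Σ-map-δ a b _ (Δword w))

  -- The first letter of w goes either to the left or to the right tensor factor.
  ΔCoeffOfLength-suc : ∀ m H u v → ΔCoeffOfLength (suc m) H u v ≈ peelˡ m H u v + peelʳ m H u v
  ΔCoeffOfLength-suc m H u v = begin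
    ΔCoeffOfLength (suc m) H u v
      ≈⟨ Σ-wordsOfLength-suc m (λ w → Σ (map (λ p → indicator u v p (H w)) (Δword w))) ⟩
    Σ (map (λ w → Σ (map (κ X w) (Δword (X ∷ w))) + Σ (map (κ Y w) (Δword (Y ∷ w)))) W)
      ≈⟨ Σ-map-cong (λ w → +-cong (Σ-Δword-∷ X w (κ X w)) (Σ-Δword-∷ Y w (κ Y w))) W ⟩
    Σ (map (λ w → (L X w + R X w) + (L Y w + R Y w)) W)
      ≈⟨ Σ-map-cong (λ w → interchange (L X w) (R X w) (L Y w) (R Y w)) W ⟩
    Σ (map (λ w → (L X w + L Y w) + (R X w + R Y w)) W)
      ≈⟨ Σ-map-+ _ _ W ⟩
    Σ (map (λ w → L X w + L Y w) W) + Σ (map (λ w → R X w + R Y w) W)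
      ≈⟨ +-cong (Σ-leftPart m H u v) (Σ-rightPart m H u v) ⟩
    peelˡ m H u v + peelʳ m H u v ∎
    where
    W = wordsOfLength m
    κ : Letter → Word → Word × Word → Carrier
    κ b w p = indicator u v p (H (b ∷ w))
    L R : Letter → Word → Carrier
    L = leftPart H u v
    R = rightPart H u v

  Σ-ш-∷-∷ : ∀ H a b u v → Σ (map H ((a ∷ u) ш (b ∷ v))) ≈
    Σ (map (λ w → H (a ∷ w)) (u ш (b ∷ v))) + Σ (map (λ w → H (b ∷ w)) ((a ∷ u) ш v))
  Σ-ш-∷-∷ H a b u v = begin
    Σ (map H (map (a ∷_) U ++ map (b ∷_) V))                ≡⟨ ≡.cong Σ (map-++ H (map (a ∷_) U) (map (b ∷_) V)) ⟩
    Σ (map H (map (a ∷_) U) ++ map H (map (b ∷_) V))        ≈⟨ Σ-++ (map H (map (a ∷_) U)) _ ⟩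
    Σ (map H (map (a ∷_) U)) + Σ (map H (map (b ∷_) V))     ≡⟨ ≡.cong₂ (λ xs ys → Σ xs + Σ ys) (map-∘ U) (map-∘ V) ⟨
    Σ (map (λ w → H (a ∷ w)) U) + Σ (map (λ w → H (b ∷ w)) V) ∎
    where
    U = u ш (b ∷ v)
    V = (a ∷ u) ш v

  ΔCoeffOfLength-ш : ∀ m H u v → length u ℕ.+ length v ≡ m → ΔCoeffOfLength m H u v ≈ Σ (map H (u ш v))
  ΔCoeffOfLength-ш zero    H []      []      _  = +-identityʳ _
  ΔCoeffOfLength-ш (suc m) H []      (b ∷ v) eq = begin
    ΔCoeffOfLength (suc m) H [] (b ∷ v)               ≈⟨ ΔCoeffOfLength-suc m H [] (b ∷ v) ⟩
    0# + ΔCoeffOfLength m (λ w → H (b ∷ w)) [] v      ≈⟨ +-identityˡ _ ⟩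
    ΔCoeffOfLength m (λ w → H (b ∷ w)) [] v           ≈⟨ ΔCoeffOfLength-ш m _ [] v (suc-injective eq) ⟩
    Σ (map H ((b ∷ v) ∷ []))                          ∎
  ΔCoeffOfLength-ш (suc m) H (a ∷ u) []      eq = begin
    ΔCoeffOfLength (suc m) H (a ∷ u) []               ≈⟨ ΔCoeffOfLength-suc m H (a ∷ u) [] ⟩
    ΔCoeffOfLength m (λ w → H (a ∷ w)) u [] + 0#      ≈⟨ +-identityʳ _ ⟩
    ΔCoeffOfLength m (λ w → H (a ∷ w)) u []           ≈⟨ ΔCoeffOfLength-ш m _ u [] (suc-injective eq) ⟩
    Σ (map (λ w → H (a ∷ w)) (u ш []))                ≡⟨ ≡.cong (λ ws → Σ (map (λ w → H (a ∷ w)) ws)) (ш-identityʳ u) ⟩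
    Σ (map H ((a ∷ u) ∷ []))                          ∎
  ΔCoeffOfLength-ш (suc m) H (a ∷ u) (b ∷ v) eq = begin
    ΔCoeffOfLength (suc m) H (a ∷ u) (b ∷ v)
      ≈⟨ ΔCoeffOfLength-suc m H (a ∷ u) (b ∷ v) ⟩
    ΔCoeffOfLength m (λ w → H (a ∷ w)) u (b ∷ v) + ΔCoeffOfLength m (λ w → H (b ∷ w)) (a ∷ u) v
      ≈⟨ +-cong (ΔCoeffOfLength-ш m _ u (b ∷ v) (suc-injective eq))
                (ΔCoeffOfLength-ш m _ (a ∷ u) v (suc-injective (≡.trans (≡.sym (+-suc (length (a ∷ u)) (length v))) eq))) ⟩
    Σ (map (λ w → H (a ∷ w)) (u ш (b ∷ v))) + Σ (map (λ w → H (b ∷ w)) ((a ∷ u) ш v))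
      ≈⟨ Σ-ш-∷-∷ H a b u v ⟨
    Σ (map H ((a ∷ u) ш (b ∷ v))) ∎

  ΔCoeff-ш : ∀ H u v → ΔCoeff H u v ≈ Σ (map H (u ш v))
  ΔCoeff-ш H u v = trans (reflexive (ΔCoeff≡ΔCoeffOfLength H u v)) (ΔCoeffOfLength-ш _ H u v ≡.refl)

  IsGroupLike⇒shuffle : ∀ {J} → IsGroupLike J → ∀ u v → J u * J v ≈ Σ (map J (u ш v))
  IsGroupLike⇒shuffle {J} (_ , Δ≈⊗) u v = trans (sym (Δ≈⊗ u v)) (ΔCoeff-ш J u v)

  -- raiseSum f (k₁ ∷ ⋯ ∷ k_d) = Σᵢ (kᵢ + 1) f (k₁ ∷ ⋯ ∷ kᵢ + 1 ∷ ⋯ ∷ k_d)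
  raiseSum : (List ℕ → Carrier) → List ℕ → Carrier
  raiseSum f []       = 0#
  raiseSum f (k ∷ ks) = ι (suc k) * f (suc k ∷ ks) + raiseSum (λ l → f (k ∷ l)) ks

  raiseSum-cong : ∀ {f g : List ℕ → Carrier} → (∀ l → f l ≈ g l) → ∀ ks → raiseSum f ks ≈ raiseSum g ks
  raiseSum-cong f≈g []       = refl
  raiseSum-cong f≈g (k ∷ ks) = +-cong (*-congˡ (f≈g _)) (raiseSum-cong (λ l → f≈g (k ∷ l)) ks)

  raiseSum-*ˡ : ∀ x f ks → raiseSum (λ l → x * f l) ks ≈ x * raiseSum f ks
  raiseSum-*ˡ x f []       = sym (zeroʳ x)
  raiseSum-*ˡ x f (k ∷ ks) = begin
    ι (suc k) * (x * f (suc k ∷ ks)) + raiseSum (λ l → x * f (k ∷ l)) ks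
      ≈⟨ +-cong (x∙yz≈y∙xz _ _ _) (raiseSum-*ˡ x (λ l → f (k ∷ l)) ks) ⟩
    x * (ι (suc k) * f (suc k ∷ ks)) + x * raiseSum (λ l → f (k ∷ l)) ks
      ≈⟨ distribˡ x _ _ ⟨
    x * raiseSum f (k ∷ ks) ∎

  raiseSum-Conv : ∀ n (h : List ℕ → ℕ → ℕ → Carrier) ks →
    raiseSum (λ l → Conv n (h l)) ks ≈ Conv n (λ u v → raiseSum (λ l → h l u v) ks)
  raiseSum-Conv n h []       = sym (Conv-zero n)
  raiseSum-Conv n h (k ∷ ks) = begin
    ι (suc k) * Conv n (h (suc k ∷ ks)) + raiseSum (λ l → Conv n (h (k ∷ l))) ks
      ≈⟨ +-cong (sym (Conv-*ˡ n (ι (suc k)) (h (suc k ∷ ks)))) (raiseSum-Conv n (λ l → h (k ∷ l)) ks) ⟩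
    Conv n (λ u v → ι (suc k) * h (suc k ∷ ks) u v) + Conv n (λ u v → raiseSum (λ l → h (k ∷ l) u v) ks)
      ≈⟨ Conv-+ n _ _ ⟨
    Conv n (λ u v → raiseSum (λ l → h l u v) (k ∷ ks)) ∎

  ΣinsertX : Series → Word → Carrier
  ΣinsertX H u = Σ (map H (u ш (X ∷ [])))

  ΣinsertX-∷ : ∀ H a u → ΣinsertX H (a ∷ u) ≈ ΣinsertX (λ w → H (a ∷ w)) u + H (X ∷ a ∷ u)
  ΣinsertX-∷ H a u = trans (Σ-ш-∷-∷ H a X u []) (+-congˡ (+-identityʳ _))

  ΣinsertX-Xⁿ : ∀ n H → ΣinsertX H (replicate n X) ≈ ι (suc n) * H (replicate (suc n) X)
  ΣinsertX-Xⁿ zero    H = trans (+-identityʳ _) (sym (trans (*-congʳ (+-identityʳ 1#)) (*-identityˡ _)))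
  ΣinsertX-Xⁿ (suc n) H = begin
    ΣinsertX H (X ∷ replicate n X)                          ≈⟨ ΣinsertX-∷ H X (replicate n X) ⟩
    ΣinsertX (λ w → H (X ∷ w)) (replicate n X) + A           ≈⟨ +-congʳ (ΣinsertX-Xⁿ n (λ w → H (X ∷ w))) ⟩
    ι (suc n) * A + A                                        ≈⟨ +-comm _ A ⟩
    A + ι (suc n) * A                                        ≈⟨ ι[1+n]*x≈x+ι[n]*x (suc n) A ⟨
    ι (suc (suc n)) * A                                      ∎
    where A = H (replicate (suc (suc n)) X)

  ΣinsertX-Xᵏ++ : ∀ k H r →
    ΣinsertX H (replicate k X ++ r) ≈ ι k * H (X ∷ replicate k X ++ r) + ΣinsertX (λ w → H (replicate k X ++ w)) r
  ΣinsertX-Xᵏ++ zero    H r = sym (trans (+-congʳ (zeroˡ _)) (+-identityˡ _))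
  ΣinsertX-Xᵏ++ (suc k) H r = begin
    ΣinsertX H (X ∷ replicate k X ++ r)
      ≈⟨ ΣinsertX-∷ H X (replicate k X ++ r) ⟩
    ΣinsertX (λ w → H (X ∷ w)) (replicate k X ++ r) + A
      ≈⟨ +-congʳ (ΣinsertX-Xᵏ++ k (λ w → H (X ∷ w)) r) ⟩
    (ι k * A + I) + A
      ≈⟨ xy∙z≈xz∙y _ I A ⟩
    (ι k * A + A) + I
      ≈⟨ +-congʳ (trans (+-comm _ A) (sym (ι[1+n]*x≈x+ι[n]*x k A))) ⟩
    ι (suc k) * A + I ∎
    where
    A = H (X ∷ X ∷ replicate k X ++ r)
    I = ΣinsertX (λ w → H (X ∷ replicate k X ++ w)) r

  ΣinsertX-wₖ : ∀ ks n H → ΣinsertX H (wₖ ks n) ≈ ι (suc n) * H (wₖ ks (suc n)) + raiseSum (λ l → H (wₖ l n)) ks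
  ΣinsertX-wₖ []       n H = trans (ΣinsertX-Xⁿ n H) (sym (+-identityʳ _))
  ΣinsertX-wₖ (k ∷ ks) n H = begin
    ΣinsertX H (replicate k X ++ Y ∷ r)
      ≈⟨ ΣinsertX-Xᵏ++ k H (Y ∷ r) ⟩
    ι k * A + ΣinsertX H′ (Y ∷ r)
      ≈⟨ +-congˡ (ΣinsertX-∷ H′ Y r) ⟩
    ι k * A + (ΣinsertX (λ w → H′ (Y ∷ w)) r + H′ (X ∷ Y ∷ r))
      ≈⟨ +-congˡ (+-cong (ΣinsertX-wₖ ks n (λ w → H′ (Y ∷ w))) (reflexive (≡.cong H (replicate-++-∷ k X (Y ∷ r))))) ⟩
    ι k * A + ((ι (suc n) * B + R) + A)
      ≈⟨ solve 4 (λ i a b r → i :* a :+ ((b :+ r) :+ a) := b :+ ((con 1 :+ i) :* a :+ r)) refl (ι k) A (ι (suc n) * B) R ⟩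
    ι (suc n) * B + ((1# + ι k) * A + R) ∎
    where
    r = wₖ ks n
    A = H (X ∷ replicate k X ++ Y ∷ r)
    H′ : Series
    H′ w = H (replicate k X ++ w)
    B = H′ (Y ∷ wₖ ks (suc n))
    R = raiseSum (λ l → H′ (Y ∷ wₖ l n)) ks

  InsertionRecurrence : Carrier → (List ℕ → ℕ → Carrier) → Set ℓ
  InsertionRecurrence x f = ∀ ks n → f ks n * x ≈ ι (suc n) * f ks (suc n) + raiseSum (λ l → f l n) ks

  IsGroupLike⇒InsertionRecurrence : ∀ {J} → IsGroupLike J → InsertionRecurrence (J (X ∷ [])) (λ ks n → J (wₖ ks n))
  IsGroupLike⇒InsertionRecurrence {J} groupLike ks n =
    trans (IsGroupLike⇒shuffle groupLike (wₖ ks n) (X ∷ [])) (ΣinsertX-wₖ ks n J)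

  -- binomialSum a ks s = Σ_{s₁ + ⋯ + s_d = s} C(k₁ + s₁, k₁) ⋯ C(k_d + s_d, k_d) · a (k₁ + s₁ ∷ ⋯ ∷ k_d + s_d)
  binomialSum : (List ℕ → Carrier) → List ℕ → ℕ → Carrier
  binomialSum a []       zero    = a []
  binomialSum a []       (suc s) = 0#
  binomialSum a (k ∷ ks) s       =
    Conv s (λ u v → ι ((k ℕ.+ u) C k) * binomialSum (λ l → a (k ℕ.+ u ∷ l)) ks v)

  binomialSum-zero : ∀ a ks → binomialSum a ks 0 ≈ a ks
  binomialSum-zero a []       = refl
  binomialSum-zero a (k ∷ ks) = begin
    ι ((k ℕ.+ 0) C k) * binomialSum (λ l → a (k ℕ.+ 0 ∷ l)) ks 0
      ≈⟨ *-cong (×-congˡ ([k+0]Ck≡1 k)) (binomialSum-zero _ ks) ⟩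
    (1# + 0#) * a (k ℕ.+ 0 ∷ ks)
      ≈⟨ trans (*-congʳ (+-identityʳ 1#)) (*-identityˡ _) ⟩
    a (k ℕ.+ 0 ∷ ks)
      ≡⟨ ≡.cong (λ n → a (n ∷ ks)) (ℕ.+-identityʳ k) ⟩
    a (k ∷ ks) ∎

  ι-absorption : ∀ k u → ι (suc k) * ι ((suc k ℕ.+ u) C suc k) ≈ ι (suc u) * ι ((k ℕ.+ suc u) C k)
  ι-absorption k u = begin
    ι (suc k) * ι ((suc k ℕ.+ u) C suc k)        ≈⟨ ×1-homo-* (suc k) ((suc k ℕ.+ u) C suc k) ⟨
    ι (suc k ℕ.* ((suc k ℕ.+ u) C suc k))        ≈⟨ ×-congˡ ([1+u]*[k+1+u]Ck≡[1+k]*[k+1+u]C[1+k] k u) ⟨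
    ι (suc u ℕ.* ((k ℕ.+ suc u) C k))            ≈⟨ ×1-homo-* (suc u) ((k ℕ.+ suc u) C k) ⟩
    ι (suc u) * ι ((k ℕ.+ suc u) C k)            ∎

  raiseSum-binomialSum : ∀ ks a s → raiseSum (λ l → binomialSum a l s) ks ≈ ι (suc s) * binomialSum a ks (suc s)
  raiseSum-binomialSum []       a s = sym (zeroʳ _)
  raiseSum-binomialSum (k ∷ ks) a s = begin
    ι (suc k) * Conv s (λ u v → ι ((suc k ℕ.+ u) C suc k) * B (suc k ℕ.+ u) ks v)
      + raiseSum (λ l → Conv s (λ u v → ι ((k ℕ.+ u) C k) * B (k ℕ.+ u) l v)) ks
      ≈⟨ +-cong (sym (Conv-*ˡ s (ι (suc k)) _)) (raiseSum-Conv s (λ l u v → ι ((k ℕ.+ u) C k) * B (k ℕ.+ u) l v) ks) ⟩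
    Conv s (λ u v → ι (suc k) * (ι ((suc k ℕ.+ u) C suc k) * B (suc k ℕ.+ u) ks v))
      + Conv s (λ u v → raiseSum (λ l → ι ((k ℕ.+ u) C k) * B (k ℕ.+ u) l v) ks)
      ≈⟨ +-cong (Conv-cong s absorb) (Conv-cong s raise) ⟩
    Conv s (λ u v → ι (suc u) * h (suc u) v) + Conv s (λ u v → ι (suc v) * h u (suc v))
      ≈⟨ Conv-leibniz s h ⟨
    ι (suc s) * binomialSum a (k ∷ ks) (suc s) ∎
    where
    B : ℕ → List ℕ → ℕ → Carrier
    B n = binomialSum (λ l → a (n ∷ l))
    h : ℕ → ℕ → Carrier
    h u v = ι ((k ℕ.+ u) C k) * B (k ℕ.+ u) ks v
    absorb : ∀ u v → ι (suc k) * (ι ((suc k ℕ.+ u) C suc k) * B (suc k ℕ.+ u) ks v) ≈ ι (suc u) * h (suc u) v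
    absorb u v = begin
      ι (suc k) * (ι ((suc k ℕ.+ u) C suc k) * B (suc k ℕ.+ u) ks v)
        ≈⟨ *-assoc _ _ _ ⟨
      ι (suc k) * ι ((suc k ℕ.+ u) C suc k) * B (suc k ℕ.+ u) ks v
        ≈⟨ *-cong (ι-absorption k u) (reflexive (≡.cong (λ n → B n ks v) (≡.sym (+-suc k u)))) ⟩
      ι (suc u) * ι ((k ℕ.+ suc u) C k) * B (k ℕ.+ suc u) ks v
        ≈⟨ *-assoc _ _ _ ⟩
      ι (suc u) * h (suc u) v ∎
    raise : ∀ u v → raiseSum (λ l → ι ((k ℕ.+ u) C k) * B (k ℕ.+ u) l v) ks ≈ ι (suc v) * h u (suc v)
    raise u v = begin
      raiseSum (λ l → ι ((k ℕ.+ u) C k) * B (k ℕ.+ u) l v) ks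
        ≈⟨ raiseSum-*ˡ _ (λ l → B (k ℕ.+ u) l v) ks ⟩
      ι ((k ℕ.+ u) C k) * raiseSum (λ l → B (k ℕ.+ u) l v) ks
        ≈⟨ *-congˡ (raiseSum-binomialSum ks _ v) ⟩
      ι ((k ℕ.+ u) C k) * (ι (suc v) * B (k ℕ.+ u) ks (suc v))
        ≈⟨ x∙yz≈y∙xz _ _ _ ⟩
      ι (suc v) * h u (suc v) ∎
  compositionSum : (List ℕ → Carrier) → List ℕ → ℕ → Carrier
  compositionSum a ks s =
    Σ (map (λ ss → product (zipWith (λ k sᵢ → (k ℕ.+ sᵢ) C k) ks ss) · a (zipWith ℕ._+_ ks ss))
           (compositions (length ks) s))

  compositionSum≈binomialSum : ∀ ks a s → compositionSum a ks s ≈ binomialSum a ks s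
  compositionSum≈binomialSum []       a zero    = trans (+-identityʳ _) (+-identityʳ _)
  compositionSum≈binomialSum []       a (suc s) = refl
  compositionSum≈binomialSum (k ∷ ks) a s = begin
    Σ (map f (concatMap (λ s₁ → map (s₁ ∷_) (compositions (length ks) (s ∸ s₁))) (upTo (suc s))))
      ≈⟨ Σ-map-concatMap f (λ s₁ → map (s₁ ∷_) (compositions (length ks) (s ∸ s₁))) (upTo (suc s)) ⟩
    Σ (map (λ s₁ → Σ (map f (map (s₁ ∷_) (compositions (length ks) (s ∸ s₁))))) (upTo (suc s)))
      ≈⟨ Σ-map-cong first (upTo (suc s)) ⟩
    Σ (map (λ s₁ → h s₁ (s ∸ s₁)) (upTo (suc s)))
      ≈⟨ Σ-upTo≈Conv s h ⟩
    binomialSum a (k ∷ ks) s ∎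
    where
    f : List ℕ → Carrier
    f ss = product (zipWith (λ k sᵢ → (k ℕ.+ sᵢ) C k) (k ∷ ks) ss) · a (zipWith ℕ._+_ (k ∷ ks) ss)
    a′ : ℕ → List ℕ → Carrier
    a′ s₁ l = a (k ℕ.+ s₁ ∷ l)
    h : ℕ → ℕ → Carrier
    h s₁ t = ι ((k ℕ.+ s₁) C k) * binomialSum (a′ s₁) ks t
    first : ∀ s₁ → Σ (map f (map (s₁ ∷_) (compositions (length ks) (s ∸ s₁)))) ≈ h s₁ (s ∸ s₁)
    first s₁ = begin
      Σ (map f (map (s₁ ∷_) L))                      ≡⟨ ≡.cong Σ (map-∘ L) ⟨
      Σ (map (λ ss → f (s₁ ∷ ss)) L)                 ≈⟨ Σ-map-cong split L ⟩
      Σ (map (λ ss → ι b * g ss) L)                  ≈⟨ Σ-map-*ˡ (ι b) g L ⟩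
      ι b * compositionSum (a′ s₁) ks (s ∸ s₁)       ≈⟨ *-congˡ (compositionSum≈binomialSum ks (a′ s₁) (s ∸ s₁)) ⟩
      h s₁ (s ∸ s₁)                                  ∎
      where
      L = compositions (length ks) (s ∸ s₁)
      b = (k ℕ.+ s₁) C k
      g : List ℕ → Carrier
      g ss = product (zipWith (λ k sᵢ → (k ℕ.+ sᵢ) C k) ks ss) · a′ s₁ (zipWith ℕ._+_ ks ss)
      split : ∀ ss → f (s₁ ∷ ss) ≈ ι b * g ss
      split ss = begin
        (b ℕ.* p) · x       ≈⟨ ·≈ι* (b ℕ.* p) x ⟩
        ι (b ℕ.* p) * x     ≈⟨ *-congʳ (×1-homo-* b p) ⟩
        ι b * ι p * x       ≈⟨ *-assoc _ _ _ ⟩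
        ι b * (ι p * x)     ≈⟨ *-congˡ (·≈ι* p x) ⟨
        ι b * (p · x)       ∎
        where
        p = product (zipWith (λ k sᵢ → (k ℕ.+ sᵢ) C k) ks ss)
        x = a′ s₁ (zipWith ℕ._+_ ks ss)

  expCoeff : Carrier → ℕ → Carrier
  expCoeff x t = (x ^ t) * ι (t !) ⁻¹

  closedFormTerm : Carrier → (List ℕ → Carrier) → List ℕ → ℕ → ℕ → Carrier
  closedFormTerm x a ks s t = (- 1#) ^ s * expCoeff x t * binomialSum a ks s

  closedForm : Carrier → (List ℕ → Carrier) → List ℕ → ℕ → Carrier
  closedForm x a ks n = Conv n (closedFormTerm x a ks)

  rhs≈closedForm : ∀ J ks n → rhs J ks n ≈ closedForm (J (X ∷ [])) (λ l → J (wₖ l 0)) ks n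
  rhs≈closedForm J ks n = trans (Σ-upTo≈Conv n _)
    (Conv-cong n (λ s t → *-congˡ (compositionSum≈binomialSum ks (λ l → J (wₖ l 0)) s)))

  closedFormTerm-sucˢ : ∀ x a ks s t →
    ι (suc s) * closedFormTerm x a ks (suc s) t + raiseSum (λ l → closedFormTerm x a l s t) ks ≈ 0#
  closedFormTerm-sucˢ x a ks s t = begin
    ι (suc s) * (- 1# * σ * e * B (suc s)) + raiseSum (λ l → σ * e * binomialSum a l s) ks
      ≈⟨ +-congˡ (trans (raiseSum-*ˡ (σ * e) (λ l → binomialSum a l s) ks) (*-congˡ (raiseSum-binomialSum ks a s))) ⟩
    ι (suc s) * (- 1# * σ * e * B (suc s)) + σ * e * (ι (suc s) * B (suc s))
      ≈⟨ +-congʳ (solve 5 (λ i m σ e b → i :* (m :* σ :* e :* b) := m :* (σ :* e :* (i :* b))) refl _ _ _ _ _) ⟩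
    - 1# * y + y   ≈⟨ +-congʳ (-1*x≈-x y) ⟩
    - y + y        ≈⟨ -‿inverseˡ y ⟩
    0#             ∎
    where
    σ = (- 1#) ^ s
    e = expCoeff x t
    B = binomialSum a ks
    y = σ * e * (ι (suc s) * B (suc s))

  module _ (charZero : CharZero) where

    ι≉0 : ∀ {n} → n ≢ 0 → ¬ ι n ≈ 0#
    ι≉0 n≢0 ιn≈0 = n≢0 (charZero _ ιn≈0)

    ι[n!]≉0 : ∀ n → ¬ ι (n !) ≈ 0#
    ι[n!]≉0 n = ι≉0 (ℕ.≢-nonZero⁻¹ (n !) {{n ℕ.!≢0}})

    expCoeff-zero : ∀ x → expCoeff x 0 ≈ 1#
    expCoeff-zero x = trans (*-identityˡ _) (sym (⁻¹-unique (ι[n!]≉0 0) (trans (*-identityʳ _) (+-identityʳ 1#))))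

    expCoeff-suc : ∀ x t → ι (suc t) * expCoeff x (suc t) ≈ x * expCoeff x t
    expCoeff-suc x t = begin
      ι (suc t) * ((x * x ^ t) * ι (suc t !) ⁻¹)
        ≈⟨ solve 4 (λ i y p d → i :* ((y :* p) :* d) := y :* (p :* (i :* d))) refl (ι (suc t)) x (x ^ t) (ι (suc t !) ⁻¹) ⟩
      x * (x ^ t * (ι (suc t) * ι (suc t !) ⁻¹))
        ≈⟨ *-congˡ (*-congˡ (⁻¹-unique (ι[n!]≉0 t) ι[t!]*ι[1+t]*ι[[1+t]!]⁻¹≈1)) ⟩
      x * expCoeff x t ∎
      where
      ι[t!]*ι[1+t]*ι[[1+t]!]⁻¹≈1 : ι (t !) * (ι (suc t) * ι (suc t !) ⁻¹) ≈ 1#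
      ι[t!]*ι[1+t]*ι[[1+t]!]⁻¹≈1 = begin
        ι (t !) * (ι (suc t) * ι (suc t !) ⁻¹)   ≈⟨ x∙yz≈yx∙z _ _ _ ⟩
        ι (suc t) * ι (t !) * ι (suc t !) ⁻¹     ≈⟨ *-congʳ (×1-homo-* (suc t) (t !)) ⟨
        ι (suc t !) * ι (suc t !) ⁻¹             ≈⟨ ⁻¹-inverse _ (ι[n!]≉0 (suc t)) ⟩
        1#                                       ∎

    closedFormTerm-sucᵗ : ∀ x a ks s t → ι (suc t) * closedFormTerm x a ks s (suc t) ≈ x * closedFormTerm x a ks s t
    closedFormTerm-sucᵗ x a ks s t = begin
      ι (suc t) * (σ * expCoeff x (suc t) * B)
        ≈⟨ solve 4 (λ i σ e b → i :* (σ :* e :* b) := σ :* (i :* e) :* b) refl _ _ _ _ ⟩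
      σ * (ι (suc t) * expCoeff x (suc t)) * B
        ≈⟨ *-congʳ (*-congˡ (expCoeff-suc x t)) ⟩
      σ * (x * expCoeff x t) * B
        ≈⟨ solve 4 (λ σ y e b → σ :* (y :* e) :* b := y :* (σ :* e :* b)) refl _ _ _ _ ⟩
      x * (σ * expCoeff x t * B) ∎
      where
      σ = (- 1#) ^ s
      B = binomialSum a ks s

    closedForm-zero : ∀ x a ks → closedForm x a ks 0 ≈ a ks
    closedForm-zero x a ks =
      trans (*-cong (trans (*-identityˡ _) (expCoeff-zero x)) (binomialSum-zero a ks)) (*-identityˡ (a ks))

    -- Differentiate the Cauchy product (−1)^s B_s ⋆ x^t / t!: the s-derivative is cancelled by
    -- raiseSum (closedFormTerm-sucˢ), the t-derivative is multiplication by x.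
    closedForm-recurrence : ∀ x a → InsertionRecurrence x (closedForm x a)
    closedForm-recurrence x a ks n = begin
      closedForm x a ks n * x                          ≈⟨ *-comm _ x ⟩
      x * Conv n (h ks)                                ≈⟨ Conv-*ˡ n x (h ks) ⟨
      Conv n (λ s t → x * h ks s t)                    ≈⟨ Conv-cong n (closedFormTerm-sucᵗ x a ks) ⟨
      Tsum                                             ≈⟨ +-identityˡ Tsum ⟨
      0# + Tsum                                        ≈⟨ +-congʳ Ssum+R≈0 ⟨
      (Ssum + R) + Tsum                                ≈⟨ xy∙z≈xz∙y Ssum R Tsum ⟩
      (Ssum + Tsum) + R                                ≈⟨ +-congʳ (Conv-leibniz n (h ks)) ⟨
      ι (suc n) * closedForm x a ks (suc n) + R        ∎
      where
      h = closedFormTerm x a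
      R = raiseSum (λ l → closedForm x a l n) ks
      Ssum = Conv n (λ s t → ι (suc s) * h ks (suc s) t)
      Tsum = Conv n (λ s t → ι (suc t) * h ks s (suc t))
      Ssum+R≈0 : Ssum + R ≈ 0#
      Ssum+R≈0 = begin
        Ssum + R                                                                   ≈⟨ +-congˡ (raiseSum-Conv n h ks) ⟩
        Ssum + Conv n (λ s t → raiseSum (λ l → h l s t) ks)                        ≈⟨ Conv-+ n _ _ ⟨
        Conv n (λ s t → ι (suc s) * h ks (suc s) t + raiseSum (λ l → h l s t) ks)  ≈⟨ Conv-cong n (closedFormTerm-sucˢ x a ks) ⟩
        Conv n (λ _ _ → 0#)                                                        ≈⟨ Conv-zero n ⟩
        0#                                                                         ∎

    InsertionRecurrence-unique : ∀ {x f g} → InsertionRecurrence x f → InsertionRecurrence x g →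
      (∀ ks → f ks 0 ≈ g ks 0) → ∀ n ks → f ks n ≈ g ks n
    InsertionRecurrence-unique recᶠ recᵍ f≈g zero    ks = f≈g ks
    InsertionRecurrence-unique {x} {f} {g} recᶠ recᵍ f≈g (suc n) ks =
      *-cancelˡ-≉0 (ι≉0 {suc n} λ ()) (∙-cancelʳ (raiseSum (λ l → f l n) ks) _ _ (begin
        ι (suc n) * f ks (suc n) + raiseSum (λ l → f l n) ks   ≈⟨ recᶠ ks n ⟨
        f ks n * x                                              ≈⟨ *-congʳ (IH ks) ⟩
        g ks n * x                                              ≈⟨ recᵍ ks n ⟩
        ι (suc n) * g ks (suc n) + raiseSum (λ l → g l n) ks   ≈⟨ +-congˡ (raiseSum-cong (λ l → sym (IH l)) ks) ⟩
        ι (suc n) * g ks (suc n) + raiseSum (λ l → f l n) ks   ∎))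
      where
      IH = InsertionRecurrence-unique recᶠ recᵍ f≈g n

theorem4p1 : ∀ {c ℓ} (F : Field c ℓ) → FieldOps.CharZero F →
    (J : FieldOps.Series F) → FieldOps.IsGroupLike F J →
    (ks : List ℕ) (k∞ : ℕ) →
    Field._≈_ F (J (wₖ ks k∞)) (FieldOps.rhs F J ks k∞)
theorem4p1 F charZero J groupLike ks k∞ = begin
  J (wₖ ks k∞)                ≈⟨ InsertionRecurrence-unique charZero
                                    (IsGroupLike⇒InsertionRecurrence groupLike)
                                    (closedForm-recurrence charZero cₓ a)
                                    (λ l → sym (closedForm-zero charZero cₓ a l)) k∞ ks ⟩
  closedForm cₓ a ks k∞       ≈⟨ rhs≈closedForm J ks k∞ ⟨
  FieldOps.rhs F J ks k∞      ∎
  where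
  open Field F using (setoid; sym)
  open import Relation.Binary.Reasoning.Setoid setoid
  open Coefficients F
  cₓ = J (X ∷ [])
  a : List ℕ → Field.Carrier F
  a l = J (wₖ l 0)
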